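{- Let $N=p_1^{\alpha_1}\cdots p_k^{\alpha_k}$ with distinct primes $p_j$ and $\alpha_j\ge1$. For $\xi\in\mathbb{Z}_N$ and $v\mid N$ define $G_\xi(v)=\sum_{d\mid\gcd(v,\xi)}\mu(v/d)\,d$. Then for all $\xi,\xi'\in\mathbb{Z}_N$, $$\sum_{v\mid N}\frac{1}{\phi(v)}G_\xi(v)G_{\xi'}(v)=\begin{cases}\dfrac{N}{\phi(N/d)}&\text{if }\gcd(\xi,N)=\gcd(\xi',N)=d,\\[2mm]0&\text{if }\gcd(\xi,N)\neq\gcd(\xi',N).\end{cases}$$
   Context: $\mu$ is the Möbius function and $\phi$ Euler's totient function; $\gcd(v,\xi)$ for $v\mid N$ and $\xi\in\mathbb{Z}_N$ is computed using any integer representative of $\xi$ (it is independent of the choice). -}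

module Defs where

open import Data.Nat using (ℕ; zero; suc; _*_; _/_)
open import Data.Nat.Divisibility using (_∣_; _∣?_)
open import Data.Nat.GCD using (gcd)
open import Data.Nat.Primality using (Prime; prime?)
open import Data.List using (List; filter; length; map; foldr; upTo)
open import Data.Integer as ℤ using (ℤ; +_; -_)
open import Data.Rational as ℚ using (ℚ; 0ℚ)
open import Data.Bool using (if_then_else_)
open import Data.List.Relation.Unary.Any using () renaming (any? to anyL?)
open import Relation.Nullary.Decidable using (does)

range1 : ℕ → List ℕ
range1 n = map suc (upTo n)

divisors : ℕ → List ℕ
divisors n = filter (λ d → d ∣? n) (range1 n)

-- total division: m div d = ⌊m/d⌋ for d ≥ 1 (only used with d ∣ m, d ≥ 1)
_div_ : ℕ → ℕ → ℕ
m div zero    = zero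
m div (suc k) = m / suc k

φ : ℕ → ℕ
φ n = length (filter (λ k → gcd k n Data.Nat.≟ 1) (range1 n))

ω : ℕ → ℕ
ω n = length (filter (λ p → prime? p Relation.Nullary.×-dec p ∣? n) (range1 n))
  where import Relation.Nullary

squarefree? : ℕ → Data.Bool.Bool
squarefree? n = Data.Bool.not (does (anyL? (λ d → (suc (suc d) * suc (suc d)) ∣? n) (upTo n)))

μ : ℕ → ℤ
μ n = if squarefree? n then (ℤ.+ 1 ℤ.* ((ℤ.- ℤ.+ 1) ℤ.^ ω n)) else ℤ.+ 0

sumℤ : List ℤ → ℤ
sumℤ = foldr ℤ._+_ (ℤ.+ 0)

sumℚ : List ℚ → ℚ
sumℚ = foldr ℚ._+_ 0ℚ

-- 1/n as a rational, for n ≥ 1 (convention 1/0 := 0, never used since φ(v) ≥ 1)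
inv : ℕ → ℚ
inv zero    = 0ℚ
inv (suc n) = ℤ.+ 1 ℚ./ suc n

-- G_ξ(v) = Σ_{d ∣ gcd(v,ξ)} μ(v/d) d   (ξ given by an integer representative)
G : ℕ → ℕ → ℤ
G ξ v = sumℤ (map (λ d → μ (v div d) ℤ.* ℤ.+ d) (divisors (gcd v ξ)))

S : ℕ → ℕ → ℕ → ℚ
S N ξ ξ' = sumℚ (map (λ v → ((G ξ v ℤ.* G ξ' v) ℚ./ 1) ℚ.* inv (φ v)) (divisors N))

{-# OPTIONS --safe #-}
-- For v ∣ N, G_ξ(v) is the Ramanujan sum c_v(b) = Σ_{d ∣ (v,b)} μ(v/d) d at b = gcd(ξ,N), so the sum
-- is Σ_{v ∣ N} c_v(a) c_v(b) / φ(v) with a = gcd(ξ,N) and b = gcd(ξ′,N).  Expanding products and using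
-- Σ_{L ∣ b ∣ N} φ(N/b) = N/L, d e = lcm(d,e) gcd(d,e), gcd(d,e) = Σ_{f ∣ d, f ∣ e} φ(f) and Möbius
-- inversion gives the orthogonality of columns, Σ_{b ∣ N} φ(N/b) c_v(b) c_w(b) = [v = w] N φ(v).
-- The square matrix (c_w(b))_{w,b ∣ N} is invertible: Σ_{w ∣ m} c_w(b) = [m ∣ b] m recovers from
-- Σ_b E(b) c_w(b) the sums of E over multiples of m, and these determine E by Möbius inversion.
-- Comparing the transforms of b ↦ φ(N/b) Σ_v c_v(a) c_v(b)/φ(v) and b ↦ [b = a] N, which agree by
-- column orthogonality, yields the orthogonality of rows, which is the theorem.
module Submission where

open import Defs

open import Data.Bool using (Bool; true; false; not)
open import Data.Empty using (⊥-elim)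
open import Data.Fin using (Fin; toℕ)
open import Data.Integer as ℤ using (ℤ; +_)
import Data.Integer.Properties as ℤP
open import Data.List using (List; []; _∷_; [_]; filter; map; length; upTo)
import Data.List.Properties as List
open import Data.List.Membership.Propositional using (_∈_; lose)
open import Data.List.Membership.Propositional.Properties
  using (∈-map⁺; ∈-map⁻; ∈-upTo⁺; ∈-upTo⁻; ∈-filter⁺; ∈-filter⁻)
open import Data.List.Membership.Propositional.Properties.WithK using (unique∧set⇒bag)
open import Data.List.Relation.Binary.BagAndSetEquality using (∼bag⇒↭)
open import Data.List.Relation.Binary.Permutation.Propositional using (_↭_; refl; prep; swap; trans)
open import Data.List.Relation.Binary.Permutation.Propositional.Properties using (↭-length)
open import Data.List.Relation.Unary.All using (All; []; _∷_)
import Data.List.Relation.Unary.All as All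
import Data.List.Relation.Unary.All.Properties as All
open import Data.List.Relation.Unary.AllPairs using ([]; _∷_)
open import Data.List.Relation.Unary.Any using (Any; here; there; satisfied) renaming (any? to anyL?)
open import Data.List.Relation.Unary.Unique.Propositional using (Unique)
import Data.List.Relation.Unary.Unique.Propositional.Properties as Unique
open import Data.Nat as ℕ using (ℕ; zero; suc; _≤_; _<_; z≤n; s≤s; _≟_)
import Data.Nat.Properties as ℕP
open import Data.Nat.Coprimality using (Coprime)
import Data.Nat.Coprimality as Coprime
open import Data.Nat.Divisibility
  using (_∣_; _∣?_; divides; ∣⇒≤; 0∣⇒≡0; ∣-trans; ∣-refl; *-monoʳ-∣; *-pres-∣; *-cancelˡ-∣; m∣m*n; n∣m*n)
open import Data.Nat.DivMod using (m*n/n≡m; m/n*n≡m; m*[n/m]≡n)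
open import Data.Nat.GCD using (gcd; gcd[m,n]∣m; gcd[m,n]∣n; gcd-greatest; gcd-zeroˡ; c*gcd[m,n]≡gcd[cm,cn])
open import Data.Nat.LCM using (lcm; m∣lcm[m,n]; n∣lcm[m,n]; lcm-least; gcd*lcm)
open import Data.Nat.ListAction using (product)
open import Data.Nat.Primality using (Prime; prime?; prime⇒irreducible; prime⇒nonTrivial; euclidsLemma)
open import Data.Nat.Primality.Factorisation using (factorise)
open import Data.Product using (_×_; _,_; proj₁; proj₂; ∃)
open import Data.Rational as ℚ using (ℚ; mkℚ; 0ℚ; 1ℚ; _+_; _*_; -_)
import Data.Rational.Properties as ℚP
open import Data.Rational.Solver using (module +-*-Solver)
open import Data.Sum using (inj₁; inj₂; [_,_]′)
open import Function using (_∘_)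
open import Function.Bundles using (_⇔_; mk⇔; Equivalence)
open import Relation.Binary.PropositionalEquality
  using (_≡_; _≢_; refl; sym; cong; cong₂; subst; subst₂; module ≡-Reasoning)
  renaming (trans to ≡-trans)
open import Relation.Nullary using (Dec; yes; no; does; ¬_; ¬?; _×-dec_)
open import Relation.Unary using (Pred; Decidable)

open +-*-Solver

-- Indicators and finite sums

𝟙 : {P : Set} → Dec P → ℚ
𝟙 (yes _) = 1ℚ
𝟙 (no _)  = 0ℚ

𝟙-yes : {P : Set} (P? : Dec P) → P → 𝟙 P? ≡ 1ℚ
𝟙-yes (yes _) _ = refl
𝟙-yes (no ¬p) p = ⊥-elim (¬p p)

𝟙-no : {P : Set} (P? : Dec P) → ¬ P → 𝟙 P? ≡ 0ℚ
𝟙-no (yes p) ¬p = ⊥-elim (¬p p)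
𝟙-no (no _)  _  = refl

𝟙-cong : {P Q : Set} (P? : Dec P) (Q? : Dec Q) → (P → Q) → (Q → P) → 𝟙 P? ≡ 𝟙 Q?
𝟙-cong (yes _) (yes _) _   _   = refl
𝟙-cong (no _)  (no _)  _   _   = refl
𝟙-cong (yes p) (no ¬q) p⇒q _   = ⊥-elim (¬q (p⇒q p))
𝟙-cong (no ¬p) (yes q) _   q⇒p = ⊥-elim (¬p (q⇒p q))

𝟙-* : {P Q : Set} (P? : Dec P) (Q? : Dec Q) → 𝟙 P? * 𝟙 Q? ≡ 𝟙 (P? ×-dec Q?)
𝟙-* (yes _) (yes _) = refl
𝟙-* (yes _) (no _)  = refl
𝟙-* (no _)  (yes _) = refl
𝟙-* (no _)  (no _)  = refl

𝟙-¬ : {P : Set} (P? : Dec P) → 𝟙 P? + 𝟙 (¬? P?) ≡ 1ℚ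
𝟙-¬ (yes _) = refl
𝟙-¬ (no _)  = refl

𝟙-≟-* : ∀ f v w → 𝟙 (f ≟ v) * 𝟙 (f ≟ w) ≡ 𝟙 (f ≟ v) * 𝟙 (v ≟ w)
𝟙-≟-* f v w with f ≟ v
... | yes refl = refl
... | no _     = ≡-trans (ℚP.*-zeroˡ (𝟙 (f ≟ w))) (sym (ℚP.*-zeroˡ (𝟙 (v ≟ w))))

private variable A B : Set

Σ : List A → (A → ℚ) → ℚ
Σ xs f = sumℚ (map f xs)

Σ-cong : ∀ xs {f g : A → ℚ} → (∀ {x} → x ∈ xs → f x ≡ g x) → Σ xs f ≡ Σ xs g
Σ-cong []       f≗g = refl
Σ-cong (x ∷ xs) f≗g = cong₂ _+_ (f≗g (here refl)) (Σ-cong xs (λ x∈xs → f≗g (there x∈xs)))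

Σ-zero : ∀ xs {f : A → ℚ} → (∀ {x} → x ∈ xs → f x ≡ 0ℚ) → Σ xs f ≡ 0ℚ
Σ-zero []       f≗0 = refl
Σ-zero (x ∷ xs) f≗0 = cong₂ _+_ (f≗0 (here refl)) (Σ-zero xs (λ x∈xs → f≗0 (there x∈xs)))

Σ-+ : ∀ xs (f g : A → ℚ) → Σ xs (λ x → f x + g x) ≡ Σ xs f + Σ xs g
Σ-+ []       f g = refl
Σ-+ (x ∷ xs) f g = ≡-trans (cong (λ s → f x + g x + s) (Σ-+ xs f g))
  (solve 4 (λ a b c d → (a :+ b) :+ (c :+ d) := (a :+ c) :+ (b :+ d)) refl (f x) (g x) (Σ xs f) (Σ xs g))

Σ-*ˡ : ∀ xs c (f : A → ℚ) → c * Σ xs f ≡ Σ xs (λ x → c * f x)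
Σ-*ˡ []       c f = ℚP.*-zeroʳ c
Σ-*ˡ (x ∷ xs) c f = ≡-trans (ℚP.*-distribˡ-+ c (f x) (Σ xs f)) (cong (λ s → c * f x + s) (Σ-*ˡ xs c f))

Σ-*ʳ : ∀ xs c (f : A → ℚ) → Σ xs f * c ≡ Σ xs (λ x → f x * c)
Σ-*ʳ xs c f = ≡-trans (ℚP.*-comm (Σ xs f) c) (≡-trans (Σ-*ˡ xs c f) (Σ-cong xs (λ _ → ℚP.*-comm c _)))

Σ-neg : ∀ xs (f : A → ℚ) → - Σ xs f ≡ Σ xs (λ x → - f x)
Σ-neg []       f = refl
Σ-neg (x ∷ xs) f = ≡-trans (ℚP.neg-distrib-+ (f x) (Σ xs f)) (cong (λ s → - f x + s) (Σ-neg xs f))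

Σ-swap : ∀ (xs : List A) (ys : List B) (f : A → B → ℚ) →
         Σ xs (λ x → Σ ys (λ y → f x y)) ≡ Σ ys (λ y → Σ xs (λ x → f x y))
Σ-swap []       ys f = sym (Σ-zero ys (λ _ → refl))
Σ-swap (x ∷ xs) ys f = ≡-trans (cong (λ s → Σ ys (f x) + s) (Σ-swap xs ys f))
                               (sym (Σ-+ ys (f x) (λ y → Σ xs (λ x′ → f x′ y))))

Σ-swap₃ : ∀ {C : Set} (xs : List A) (ys : List B) (zs : List C) (F : A → B → C → ℚ) →
          Σ xs (λ x → Σ ys (λ y → Σ zs (λ z → F x y z))) ≡ Σ zs (λ z → Σ xs (λ x → Σ ys (λ y → F x y z)))
Σ-swap₃ xs ys zs F = ≡-trans (Σ-cong xs (λ {x} _ → Σ-swap ys zs (F x))) (Σ-swap xs zs (λ x z → Σ ys (λ y → F x y z)))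

Σ-*-Σ : ∀ (xs : List A) (ys : List B) f g → Σ xs f * Σ ys g ≡ Σ xs (λ x → Σ ys (λ y → f x * g y))
Σ-*-Σ xs ys f g = ≡-trans (Σ-*ʳ xs (Σ ys g) f) (Σ-cong xs (λ {x} _ → Σ-*ˡ ys (f x) g))

Σ-*ˡ-Σ : ∀ (xs : List A) (ys : List B) c (F : A → B → ℚ) →
         c * Σ xs (λ x → Σ ys (λ y → F x y)) ≡ Σ xs (λ x → Σ ys (λ y → c * F x y))
Σ-*ˡ-Σ xs ys c F = ≡-trans (Σ-*ˡ xs c (λ x → Σ ys (F x))) (Σ-cong xs (λ {x} _ → Σ-*ˡ ys c (F x)))

Σ-map : ∀ (xs : List B) (g : B → A) (f : A → ℚ) → Σ (map g xs) f ≡ Σ xs (λ x → f (g x))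
Σ-map []       g f = refl
Σ-map (x ∷ xs) g f = cong (λ s → f (g x) + s) (Σ-map xs g f)

Σ-filter : ∀ {P : Pred A _} (P? : Decidable P) xs (f : A → ℚ) →
           Σ (filter P? xs) f ≡ Σ xs (λ x → 𝟙 (P? x) * f x)
Σ-filter P? []       f = refl
Σ-filter P? (x ∷ xs) f with P? x
... | yes _ = cong₂ _+_ (sym (ℚP.*-identityˡ (f x))) (Σ-filter P? xs f)
... | no _  = ≡-trans (Σ-filter P? xs f) (solve 2 (λ a s → s := con 0ℚ :* a :+ s) refl (f x) _)

Σ-split : ∀ {P : Pred A _} (P? : Decidable P) xs (f : A → ℚ) →
          Σ xs f ≡ Σ xs (λ x → 𝟙 (P? x) * f x) + Σ xs (λ x → 𝟙 (¬? (P? x)) * f x)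
Σ-split P? xs f = ≡-trans (Σ-cong xs split) (Σ-+ xs _ _)
  where
  split : ∀ {x} → x ∈ xs → f x ≡ 𝟙 (P? x) * f x + 𝟙 (¬? (P? x)) * f x
  split {x} _ = begin
    f x                                           ≡⟨ sym (ℚP.*-identityˡ (f x)) ⟩
    1ℚ * f x                                      ≡⟨ cong (_* f x) (sym (𝟙-¬ (P? x))) ⟩
    (𝟙 (P? x) + 𝟙 (¬? (P? x))) * f x              ≡⟨ ℚP.*-distribʳ-+ (f x) (𝟙 (P? x)) (𝟙 (¬? (P? x))) ⟩
    𝟙 (P? x) * f x + 𝟙 (¬? (P? x)) * f x          ∎
    where open ≡-Reasoning

Σ-↭ : ∀ {xs ys} (f : A → ℚ) → xs ↭ ys → Σ xs f ≡ Σ ys f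
Σ-↭ f refl                = refl
Σ-↭ f (prep x xs↭ys)      = cong (λ s → f x + s) (Σ-↭ f xs↭ys)
Σ-↭ f (swap x y xs↭ys)    = ≡-trans (cong (λ s → f x + (f y + s)) (Σ-↭ f xs↭ys))
  (solve 3 (λ a b s → a :+ (b :+ s) := b :+ (a :+ s)) refl (f x) (f y) _)
Σ-↭ f (trans xs↭ys ys↭zs) = ≡-trans (Σ-↭ f xs↭ys) (Σ-↭ f ys↭zs)

Σ-unique-sameElements : ∀ {xs ys} (f : A → ℚ) → Unique xs → Unique ys →
                        (∀ {z} → z ∈ xs ⇔ z ∈ ys) → Σ xs f ≡ Σ ys f
Σ-unique-sameElements f !xs !ys xs⇔ys = Σ-↭ f (∼bag⇒↭ (unique∧set⇒bag !xs !ys xs⇔ys))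

Σ-δ : ∀ {xs a} (f : ℕ → ℚ) → Unique xs → a ∈ xs → Σ xs (λ x → 𝟙 (x ≟ a) * f x) ≡ f a
Σ-δ {xs} {a} f !xs a∈xs = begin
  Σ xs (λ x → 𝟙 (x ≟ a) * f x) ≡⟨ sym (Σ-filter (_≟ a) xs f) ⟩
  Σ (filter (_≟ a) xs) f       ≡⟨ Σ-unique-sameElements f (Unique.filter⁺ (_≟ a) !xs) ([] ∷ []) (mk⇔ to from) ⟩
  f a + 0ℚ                     ≡⟨ ℚP.+-identityʳ (f a) ⟩
  f a                          ∎
  where
  open ≡-Reasoning
  to : ∀ {z} → z ∈ filter (_≟ a) xs → z ∈ [ a ]
  to z∈ = here (proj₂ (∈-filter⁻ (_≟ a) {xs = xs} z∈))
  from : ∀ {z} → z ∈ [ a ] → z ∈ filter (_≟ a) xs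
  from (here refl) = ∈-filter⁺ (_≟ a) a∈xs refl

Σ-fibres : ∀ (xs : List A) {ys} (g : A → ℕ) (F : A → ℚ) → Unique ys → (∀ {x} → x ∈ xs → g x ∈ ys) →
           Σ xs F ≡ Σ ys (λ y → Σ xs (λ x → 𝟙 (g x ≟ y) * F x))
Σ-fibres xs {ys} g F !ys g∈ys = ≡-trans (Σ-cong xs fibre) (Σ-swap xs ys (λ x y → 𝟙 (g x ≟ y) * F x))
  where
  fibre : ∀ {x} → x ∈ xs → F x ≡ Σ ys (λ y → 𝟙 (g x ≟ y) * F x)
  fibre {x} x∈ = sym (≡-trans (Σ-cong ys (λ {y} _ → cong (_* F x) (𝟙-cong (g x ≟ y) (y ≟ g x) sym sym)))
                              (Σ-δ (λ _ → F x) !ys (g∈ys x∈)))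

unique-map⁺ : ∀ {xs : List A} (g : A → B) → (∀ {x y} → x ∈ xs → y ∈ xs → g x ≡ g y → x ≡ y) →
              Unique xs → Unique (map g xs)
unique-map⁺ {xs = []}     g inj []          = []
unique-map⁺ {xs = x ∷ xs} g inj (x∉xs ∷ !xs) =
  All.map⁺ (All.tabulate (λ y∈xs gx≡gy → All.lookup x∉xs y∈xs (inj (here refl) (there y∈xs) gx≡gy)))
  ∷ unique-map⁺ g (λ x∈ y∈ → inj (there x∈) (there y∈)) !xs

-- Integers and natural numbers as rationals

fromℤ : ℤ → ℚ
fromℤ z = z ℚ./ 1

fromℕ : ℕ → ℚ
fromℕ n = fromℤ (+ n)

coprime-1 : ∀ z → Coprime.Coprime ℤ.∣ z ∣ 1
coprime-1 z = Coprime.sym (Coprime.1-coprimeTo ℤ.∣ z ∣)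

-- On representatives with denominator 1, ℚ's _+_ and _*_ compute, which gives the laws below.
fromℤ≡mkℚ : ∀ z → fromℤ z ≡ mkℚ z 0 (coprime-1 z)
fromℤ≡mkℚ z = ℚP.↥p/↧p≡p (mkℚ z 0 (coprime-1 z))

fromℤ-+ : ∀ x y → fromℤ (x ℤ.+ y) ≡ fromℤ x + fromℤ y
fromℤ-+ x y = begin
  (x ℤ.+ y) ℚ./ 1                  ≡⟨ ℚP./-cong (cong₂ ℤ._+_ (sym (ℤP.*-identityʳ x)) (sym (ℤP.*-identityʳ y))) refl ⟩
  (x ℤ.* + 1 ℤ.+ y ℤ.* + 1) ℚ./ 1  ≡⟨ sym (cong₂ _+_ (fromℤ≡mkℚ x) (fromℤ≡mkℚ y)) ⟩
  fromℤ x + fromℤ y                ∎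
  where open ≡-Reasoning

fromℤ-* : ∀ x y → fromℤ (x ℤ.* y) ≡ fromℤ x * fromℤ y
fromℤ-* x y = sym (cong₂ _*_ (fromℤ≡mkℚ x) (fromℤ≡mkℚ y))

fromℤ-neg : ∀ x → fromℤ (ℤ.- x) ≡ - fromℤ x
fromℤ-neg x = ≡-trans (fromℤ≡mkℚ (ℤ.- x)) (≡-trans (neg-mkℚ x) (cong -_ (sym (fromℤ≡mkℚ x))))
  where
  neg-mkℚ : ∀ x → mkℚ (ℤ.- x) 0 (coprime-1 (ℤ.- x)) ≡ - mkℚ x 0 (coprime-1 x)
  neg-mkℚ (+ zero)    = refl
  neg-mkℚ (+ suc n)   = refl
  neg-mkℚ ℤ.-[1+ n ]  = refl

fromℤ-sumℤ : ∀ (xs : List A) (h : A → ℤ) → fromℤ (sumℤ (map h xs)) ≡ Σ xs (fromℤ ∘ h)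
fromℤ-sumℤ []       h = refl
fromℤ-sumℤ (x ∷ xs) h = ≡-trans (fromℤ-+ (h x) (sumℤ (map h xs))) (cong (λ s → fromℤ (h x) + s) (fromℤ-sumℤ xs h))

fromℕ-+ : ∀ m n → fromℕ (m ℕ.+ n) ≡ fromℕ m + fromℕ n
fromℕ-+ m n = ≡-trans (cong fromℤ (ℤP.pos-+ m n)) (fromℤ-+ (+ m) (+ n))

fromℕ-* : ∀ m n → fromℕ (m ℕ.* n) ≡ fromℕ m * fromℕ n
fromℕ-* m n = ≡-trans (cong fromℤ (ℤP.pos-* m n)) (fromℤ-* (+ m) (+ n))

fromℕ-length : (xs : List A) → fromℕ (length xs) ≡ Σ xs (λ _ → 1ℚ)
fromℕ-length []       = refl
fromℕ-length (x ∷ xs) = ≡-trans (fromℕ-+ 1 (length xs)) (cong (λ s → 1ℚ + s) (fromℕ-length xs))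

inv-inverseˡ : ∀ {n} → 0 < n → inv n * fromℕ n ≡ 1ℚ
inv-inverseˡ {suc k} _ = ≡-trans (cong₂ _*_ (ℚP.↥p/↧p≡p (mkℚ (+ 1) k (Coprime.1-coprimeTo _))) (fromℤ≡mkℚ (+ suc k)))
                                 (ℚP.*-inverseˡ (mkℚ (+ suc k) 0 (coprime-1 (+ suc k))))

inv-*-cancel : ∀ {n} → 0 < n → ∀ x → inv n * (fromℕ n * x) ≡ x
inv-*-cancel {n} 0<n x = begin
  inv n * (fromℕ n * x) ≡⟨ sym (ℚP.*-assoc (inv n) (fromℕ n) x) ⟩
  inv n * fromℕ n * x   ≡⟨ cong (_* x) (inv-inverseˡ 0<n) ⟩
  1ℚ * x                ≡⟨ ℚP.*-identityˡ x ⟩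
  x                     ∎
  where open ≡-Reasoning

fromℕ-*-cancelˡ : ∀ {n} → 0 < n → ∀ {x y} → fromℕ n * x ≡ fromℕ n * y → x ≡ y
fromℕ-*-cancelˡ {n} 0<n {x} {y} nx≡ny =
  ≡-trans (sym (inv-*-cancel 0<n x)) (≡-trans (cong (inv n *_) nx≡ny) (inv-*-cancel 0<n y))

*-fromℕ⇒≡*inv : ∀ {n} → 0 < n → ∀ {x y} → x * fromℕ n ≡ y → x ≡ y * inv n
*-fromℕ⇒≡*inv {n} 0<n {x} {y} xn≡y = begin
  x                     ≡⟨ sym (inv-*-cancel 0<n x) ⟩
  inv n * (fromℕ n * x) ≡⟨ cong (inv n *_) (≡-trans (ℚP.*-comm (fromℕ n) x) xn≡y) ⟩
  inv n * y             ≡⟨ ℚP.*-comm (inv n) y ⟩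
  y * inv n             ∎
  where open ≡-Reasoning

-- Divisors

divisor-pos : ∀ {d n} → 0 < n → d ∣ n → 0 < d
divisor-pos {zero}  0<n 0∣n = ⊥-elim (ℕP.<-irrefl (sym (0∣⇒≡0 0∣n)) 0<n)
divisor-pos {suc d} _   _   = s≤s z≤n

∈-range1⁺ : ∀ {d n} → 0 < d → d ≤ n → d ∈ range1 n
∈-range1⁺ {suc d} _ d<n = ∈-map⁺ suc (∈-upTo⁺ d<n)

∈-range1⁻ : ∀ {d n} → d ∈ range1 n → 0 < d × d ≤ n
∈-range1⁻ d∈ with ∈-map⁻ suc d∈
... | _ , i∈ , refl = s≤s z≤n , ∈-upTo⁻ i∈

range1-unique : ∀ n → Unique (range1 n)
range1-unique n = Unique.map⁺ ℕP.suc-injective (Unique.upTo⁺ n)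

divisors-unique : ∀ n → Unique (divisors n)
divisors-unique n = Unique.filter⁺ (_∣? n) (range1-unique n)

∈-divisors⁺ : ∀ {d n} → 0 < n → d ∣ n → d ∈ divisors n
∈-divisors⁺ {n = suc _} 0<n d∣n = ∈-filter⁺ (_∣? _) (∈-range1⁺ (divisor-pos 0<n d∣n) (∣⇒≤ d∣n)) d∣n

∈-divisors⇒∣ : ∀ {d} n → d ∈ divisors n → d ∣ n
∈-divisors⇒∣ n d∈ = proj₂ (∈-filter⁻ (_∣? n) {xs = range1 n} d∈)

∈-divisors⇒pos : ∀ {d} n → d ∈ divisors n → 0 < d
∈-divisors⇒pos n d∈ = proj₁ (∈-range1⁻ {n = n} (proj₁ (∈-filter⁻ (_∣? n) {xs = range1 n} d∈)))

div-unique : ∀ {m d q} → 0 < d → q ℕ.* d ≡ m → m div d ≡ q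
div-unique {d = suc _} {q} _ refl = m*n/n≡m q _

div-cancelʳ : ∀ {m d} → 0 < d → d ∣ m → (m div d) ℕ.* d ≡ m
div-cancelʳ {d = suc _} _ d∣m = m/n*n≡m d∣m

div-cancelˡ : ∀ {m d} → 0 < d → d ∣ m → d ℕ.* (m div d) ≡ m
div-cancelˡ {d = suc _} _ d∣m = m*[n/m]≡n d∣m

div-∣ : ∀ {m d} → 0 < d → d ∣ m → (m div d) ∣ m
div-∣ {d = d} 0<d d∣m = divides d (sym (div-cancelˡ 0<d d∣m))

div-pos : ∀ {m d} → 0 < m → d ∣ m → 0 < m div d
div-pos 0<m d∣m = divisor-pos 0<m (div-∣ (divisor-pos 0<m d∣m) d∣m)

div-involutive : ∀ {n d} → 0 < n → d ∣ n → n div (n div d) ≡ d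
div-involutive 0<n d∣n = div-unique (div-pos 0<n d∣n) (div-cancelˡ (divisor-pos 0<n d∣n) d∣n)

div-mono-∣ : ∀ {b k n} → 0 < b → b ∣ k → k ∣ n → (k div b) ∣ (n div b)
div-mono-∣ {b} {k} 0<b b∣k (divides c refl) = divides c (div-unique 0<b (begin
  c ℕ.* (k div b) ℕ.* b   ≡⟨ ℕP.*-assoc c _ b ⟩
  c ℕ.* ((k div b) ℕ.* b) ≡⟨ cong (c ℕ.*_) (div-cancelʳ 0<b b∣k) ⟩
  c ℕ.* k               ∎))
  where open ≡-Reasoning

div-*-assoc : ∀ {n l j} → 0 < n → l ∣ n → j ∣ n div l → n div (l ℕ.* j) ≡ (n div l) div j
div-*-assoc {n} {l} {j} 0<n l∣n j∣m = div-unique (ℕP.*-mono-≤ 0<l 0<j) (begin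
  (m div j) ℕ.* (l ℕ.* j) ≡⟨ cong ((m div j) ℕ.*_) (ℕP.*-comm l j) ⟩
  (m div j) ℕ.* (j ℕ.* l) ≡⟨ sym (ℕP.*-assoc (m div j) j l) ⟩
  (m div j) ℕ.* j ℕ.* l   ≡⟨ cong (ℕ._* l) (div-cancelʳ 0<j j∣m) ⟩
  m ℕ.* l               ≡⟨ div-cancelʳ 0<l l∣n ⟩
  n                   ∎)
  where
  open ≡-Reasoning
  m = n div l
  0<l = divisor-pos 0<n l∣n
  0<j = divisor-pos (div-pos 0<n l∣n) j∣m

div≡1⇔≡ : ∀ {n b} → 0 < b → b ∣ n → n div b ≡ 1 ⇔ n ≡ b
div≡1⇔≡ {n} {b} 0<b b∣n = mk⇔
  (λ n/b≡1 → ≡-trans (sym (div-cancelʳ 0<b b∣n)) (≡-trans (cong (ℕ._* b) n/b≡1) (ℕP.*-identityˡ b)))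
  (λ { refl → div-unique 0<b (ℕP.*-identityˡ b) })

div-lcm-* : ∀ {N d e} → 0 < N → d ∣ N → e ∣ N → (N div lcm d e) ℕ.* (d ℕ.* e) ≡ N ℕ.* gcd d e
div-lcm-* {N} {d} {e} 0<N d∣N e∣N = begin
  (N div l) ℕ.* (d ℕ.* e) ≡⟨ cong ((N div l) ℕ.*_) (sym (gcd*lcm d e)) ⟩
  (N div l) ℕ.* (g ℕ.* l) ≡⟨ cong ((N div l) ℕ.*_) (ℕP.*-comm g l) ⟩
  (N div l) ℕ.* (l ℕ.* g) ≡⟨ sym (ℕP.*-assoc (N div l) l g) ⟩
  (N div l) ℕ.* l ℕ.* g   ≡⟨ cong (ℕ._* g) (div-cancelʳ (divisor-pos 0<N l∣N) l∣N) ⟩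
  N ℕ.* g                 ∎
  where
  open ≡-Reasoning
  l = lcm d e
  g = gcd d e
  l∣N = lcm-least d∣N e∣N

𝟙-∣-lcm : ∀ d e b → 𝟙 (d ∣? b) * 𝟙 (e ∣? b) ≡ 𝟙 (lcm d e ∣? b)
𝟙-∣-lcm d e b = ≡-trans (𝟙-* (d ∣? b) (e ∣? b)) (𝟙-cong ((d ∣? b) ×-dec (e ∣? b)) (lcm d e ∣? b)
  (λ (d∣b , e∣b) → lcm-least d∣b e∣b) (λ l∣b → ∣-trans (m∣lcm[m,n] d e) l∣b , ∣-trans (n∣lcm[m,n] d e) l∣b))

𝟙-∣-gcd : ∀ d e f → 𝟙 (f ∣? d) * 𝟙 (f ∣? e) ≡ 𝟙 (f ∣? gcd d e)
𝟙-∣-gcd d e f = ≡-trans (𝟙-* (f ∣? d) (f ∣? e)) (𝟙-cong ((f ∣? d) ×-dec (f ∣? e)) (f ∣? gcd d e)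
  (λ (f∣d , f∣e) → gcd-greatest f∣d f∣e) (λ f∣g → ∣-trans f∣g (gcd[m,n]∣m d e) , ∣-trans f∣g (gcd[m,n]∣n d e)))

Σ-divisors-∣ : ∀ {n m} → 0 < n → m ∣ n → ∀ F →
               Σ (divisors n) (λ k → 𝟙 (k ∣? m) * F k) ≡ Σ (divisors m) F
Σ-divisors-∣ {n} {m} 0<n m∣n F = ≡-trans (sym (Σ-filter (_∣? m) (divisors n) F))
  (Σ-unique-sameElements F (Unique.filter⁺ (_∣? m) (divisors-unique n)) (divisors-unique m) (mk⇔ to from))
  where
  to : ∀ {k} → k ∈ filter (_∣? m) (divisors n) → k ∈ divisors m
  to k∈ = ∈-divisors⁺ (divisor-pos 0<n m∣n) (proj₂ (∈-filter⁻ (_∣? m) {xs = divisors n} k∈))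
  from : ∀ {k} → k ∈ divisors m → k ∈ filter (_∣? m) (divisors n)
  from k∈ = ∈-filter⁺ (_∣? m) (∈-divisors⁺ 0<n (∣-trans (∈-divisors⇒∣ m k∈) m∣n)) (∈-divisors⇒∣ m k∈)

Σ-divisors-multiples : ∀ {n b} → 0 < n → b ∣ n → ∀ F →
  Σ (divisors n) (λ k → 𝟙 (b ∣? k) * F k) ≡ Σ (divisors (n div b)) (λ j → F (b ℕ.* j))
Σ-divisors-multiples {n} {b} 0<n b∣n F = begin
  Σ (divisors n) (λ k → 𝟙 (b ∣? k) * F k) ≡⟨ sym (Σ-filter (b ∣?_) (divisors n) F) ⟩
  Σ (filter (b ∣?_) (divisors n)) F       ≡⟨ Σ-unique-sameElements F (Unique.filter⁺ (b ∣?_) (divisors-unique n))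
                                               (Unique.map⁺ (ℕP.*-cancelˡ-≡ _ _ b {{ℕ.>-nonZero 0<b}}) (divisors-unique m))
                                               (mk⇔ to from) ⟩
  Σ (map (b ℕ.*_) (divisors m)) F         ≡⟨ Σ-map (divisors m) (b ℕ.*_) F ⟩
  Σ (divisors m) (λ j → F (b ℕ.* j))      ∎
  where
  open ≡-Reasoning
  m = n div b
  0<b = divisor-pos 0<n b∣n
  to : ∀ {k} → k ∈ filter (b ∣?_) (divisors n) → k ∈ map (b ℕ.*_) (divisors m)
  to {k} k∈ with ∈-filter⁻ (b ∣?_) {xs = divisors n} k∈
  ... | k∈n , b∣k = subst (_∈ map (b ℕ.*_) (divisors m)) (div-cancelˡ 0<b b∣k)
    (∈-map⁺ (b ℕ.*_) (∈-divisors⁺ (div-pos 0<n b∣n) (div-mono-∣ 0<b b∣k (∈-divisors⇒∣ n k∈n))))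
  from : ∀ {k} → k ∈ map (b ℕ.*_) (divisors m) → k ∈ filter (b ∣?_) (divisors n)
  from k∈ with ∈-map⁻ (b ℕ.*_) k∈
  ... | j , j∈m , refl = ∈-filter⁺ (b ∣?_)
    (∈-divisors⁺ 0<n (subst (b ℕ.* j ∣_) (div-cancelˡ 0<b b∣n) (*-monoʳ-∣ b (∈-divisors⇒∣ m j∈m))))
    (m∣m*n j)

Σ-divisors-complement : ∀ {n} → 0 < n → ∀ F → Σ (divisors n) (λ d → F (n div d)) ≡ Σ (divisors n) F
Σ-divisors-complement {n} 0<n F = ≡-trans (sym (Σ-map (divisors n) (n div_) F))
  (Σ-unique-sameElements F (unique-map⁺ (n div_) injective (divisors-unique n)) (divisors-unique n) (mk⇔ to from))
  where
  complement-∈ : ∀ {d} → d ∈ divisors n → n div d ∈ divisors n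
  complement-∈ d∈ = ∈-divisors⁺ 0<n (div-∣ (∈-divisors⇒pos n d∈) (∈-divisors⇒∣ n d∈))
  involutive : ∀ {d} → d ∈ divisors n → n div (n div d) ≡ d
  involutive d∈ = div-involutive 0<n (∈-divisors⇒∣ n d∈)
  injective : ∀ {x y} → x ∈ divisors n → y ∈ divisors n → n div x ≡ n div y → x ≡ y
  injective x∈ y∈ eq = ≡-trans (sym (involutive x∈)) (≡-trans (cong (n div_) eq) (involutive y∈))
  to : ∀ {k} → k ∈ map (n div_) (divisors n) → k ∈ divisors n
  to k∈ with ∈-map⁻ (n div_) k∈
  ... | d , d∈ , refl = complement-∈ d∈
  from : ∀ {k} → k ∈ divisors n → k ∈ map (n div_) (divisors n)
  from k∈ = subst (_∈ map (n div_) (divisors n)) (involutive k∈) (∈-map⁺ (n div_) (complement-∈ k∈))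

-- The Möbius function

prime>1 : ∀ {p} → Prime p → 1 < p
prime>1 {p} p-prime = ℕ.nonTrivial⇒n>1 p {{prime⇒nonTrivial p-prime}}

prime>0 : ∀ {p} → Prime p → 0 < p
prime>0 p-prime = ℕP.<-trans (s≤s z≤n) (prime>1 p-prime)

prime∤⇒coprime : ∀ {p m} → Prime p → ¬ p ∣ m → Coprime m p
prime∤⇒coprime p-prime p∤m (d∣m , d∣p) with prime⇒irreducible p-prime d∣p
... | inj₁ d≡1 = d≡1
... | inj₂ refl = ⊥-elim (p∤m d∣m)

∃-prime-divisor : ∀ n → 1 < n → ∃ λ p → Prime p × p ∣ n
∃-prime-divisor (suc zero) (s≤s ())
∃-prime-divisor n@(suc (suc _)) _ with factorise n
... | record { factors = p ∷ ps ; isFactorisation = n≡p*ps ; factorsPrime = p-prime ∷ _ } =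
  p , p-prime , divides (product ps) (≡-trans n≡p*ps (ℕP.*-comm p (product ps)))

data SquarefreeView (n : ℕ) : Bool → Set where
  squarefree    : (∀ q → 1 < q → ¬ q ℕ.* q ∣ n) → SquarefreeView n true
  squareDivisor : ∀ q → 1 < q → q ℕ.* q ∣ n → SquarefreeView n false

squarefree?-view : ∀ {n} → 0 < n → SquarefreeView n (squarefree? n)
squarefree?-view {n@(suc _)} _ = view (anyL? (λ d → (2 ℕ.+ d) ℕ.* (2 ℕ.+ d) ∣? n) (upTo n))
  where
  view : (a : Dec (Any (λ d → (2 ℕ.+ d) ℕ.* (2 ℕ.+ d) ∣ n) (upTo n))) → SquarefreeView n (not (does a))
  view (yes any) with satisfied any
  ... | d , sq∣n = squareDivisor (2 ℕ.+ d) (s≤s (s≤s z≤n)) sq∣n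
  view (no ¬any) = squarefree λ where
    (suc zero) (s≤s ()) _
    (suc (suc d)) _ sq∣n → ¬any (lose (∈-upTo⁺ (ℕP.<-≤-trans (ℕP.n≤1+n (suc d))
                                   (ℕP.≤-trans (ℕP.m≤m*n (2 ℕ.+ d) (2 ℕ.+ d)) (∣⇒≤ sq∣n)))) sq∣n)

μ-square : ∀ {n q} → 0 < n → 1 < q → q ℕ.* q ∣ n → μ n ≡ + 0
μ-square {n} {q} 0<n 1<q sq∣n with squarefree? n | squarefree?-view 0<n
... | true  | squarefree sqfree = ⊥-elim (sqfree q 1<q sq∣n)
... | false | _                = refl

primeDivisors : ℕ → List ℕ
primeDivisors n = filter (λ p → prime? p ×-dec p ∣? n) (range1 n)

∈-primeDivisors⁺ : ∀ {n p} → 0 < n → Prime p → p ∣ n → p ∈ primeDivisors n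
∈-primeDivisors⁺ {n} 0<n p-prime p∣n = ∈-filter⁺ (λ p → prime? p ×-dec p ∣? n)
  (∈-range1⁺ (prime>0 p-prime) (∣⇒≤ {{ℕ.>-nonZero 0<n}} p∣n)) (p-prime , p∣n)

∈-primeDivisors⁻ : ∀ {n p} → p ∈ primeDivisors n → Prime p × p ∣ n
∈-primeDivisors⁻ {n} p∈ = proj₂ (∈-filter⁻ (λ p → prime? p ×-dec p ∣? n) {xs = range1 n} p∈)

primeDivisors-unique : ∀ n → Unique (primeDivisors n)
primeDivisors-unique n = Unique.filter⁺ (λ p → prime? p ×-dec p ∣? n) (range1-unique n)

ω-* : ∀ {p j} → Prime p → ¬ p ∣ j → 0 < j → ω (p ℕ.* j) ≡ suc (ω j)
ω-* {p} {j} p-prime p∤j 0<j = ↭-length (∼bag⇒↭ (unique∧set⇒bag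
  (primeDivisors-unique (p ℕ.* j)) (p∉ ∷ primeDivisors-unique j) (mk⇔ to from)))
  where
  0<pj = ℕP.*-mono-≤ (prime>0 p-prime) 0<j
  p∉ : All (p ≢_) (primeDivisors j)
  p∉ = All.tabulate (λ q∈ p≡q → p∤j (subst (_∣ j) (sym p≡q) (proj₂ (∈-primeDivisors⁻ q∈))))
  to : ∀ {q} → q ∈ primeDivisors (p ℕ.* j) → q ∈ p ∷ primeDivisors j
  to q∈ with ∈-primeDivisors⁻ q∈
  ... | q-prime , q∣pj with euclidsLemma p j q-prime q∣pj
  ...   | inj₂ q∣j = there (∈-primeDivisors⁺ 0<j q-prime q∣j)
  ...   | inj₁ q∣p with prime⇒irreducible p-prime q∣p
  ...     | inj₁ refl = ⊥-elim (ℕP.<-irrefl refl (prime>1 q-prime))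
  ...     | inj₂ q≡p  = here q≡p
  from : ∀ {q} → q ∈ p ∷ primeDivisors j → q ∈ primeDivisors (p ℕ.* j)
  from (here refl) = ∈-primeDivisors⁺ 0<pj p-prime (m∣m*n j)
  from (there q∈) with ∈-primeDivisors⁻ q∈
  ... | q-prime , q∣j = ∈-primeDivisors⁺ 0<pj q-prime (∣-trans q∣j (n∣m*n p))

squarefree-* : ∀ {p j} → Prime p → ¬ p ∣ j → (∀ q → 1 < q → ¬ q ℕ.* q ∣ j) →
               ∀ q → 1 < q → ¬ q ℕ.* q ∣ p ℕ.* j
squarefree-* {p} {j} p-prime p∤j sqfree q 1<q sq∣pj with p ∣? q
... | yes p∣q = p∤j (*-cancelˡ-∣ p {{ℕ.>-nonZero (prime>0 p-prime)}} (∣-trans (*-pres-∣ p∣q p∣q) sq∣pj))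
... | no p∤q  = sqfree q 1<q (Coprime.coprime-divisor (prime∤⇒coprime p-prime p∤q²) sq∣pj)
  where
  p∤q² : ¬ p ∣ q ℕ.* q
  p∤q² p∣q² = [ p∤q , p∤q ]′ (euclidsLemma q q p-prime p∣q²)

μ-* : ∀ {p j} → Prime p → ¬ p ∣ j → 0 < j → μ (p ℕ.* j) ≡ ℤ.- μ j
μ-* {p} {j} p-prime p∤j 0<j with squarefree? j | squarefree?-view 0<j
... | false | squareDivisor q 1<q sq∣j = μ-square 0<pj 1<q (∣-trans sq∣j (n∣m*n p))
  where 0<pj = ℕP.*-mono-≤ (prime>0 p-prime) 0<j
... | true  | squarefree sqfree with squarefree? (p ℕ.* j) | squarefree?-view (ℕP.*-mono-≤ (prime>0 p-prime) 0<j)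
...   | false | squareDivisor q 1<q sq∣pj = ⊥-elim (squarefree-* p-prime p∤j sqfree q 1<q sq∣pj)
...   | true  | _ rewrite ω-* p-prime p∤j 0<j = begin
  + 1 ℤ.* (ℤ.-1ℤ ℤ.* x) ≡⟨ ℤP.*-identityˡ _ ⟩
  ℤ.-1ℤ ℤ.* x           ≡⟨ ℤP.-1*i≡-i x ⟩
  ℤ.- x                 ≡⟨ cong ℤ.-_ (sym (ℤP.*-identityˡ x)) ⟩
  ℤ.- (+ 1 ℤ.* x)       ∎
  where
  open ≡-Reasoning
  x = (ℤ.- + 1) ℤ.^ ω j

μℚ : ℕ → ℚ
μℚ n = fromℤ (μ n)

-- For a prime p ∣ n: μ(p j) = −[p ∤ j] μ(j), and the divisors of n/p prime to p are those of n.
Σ-μ : ∀ {n} → 0 < n → Σ (divisors n) μℚ ≡ 𝟙 (n ≟ 1)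
Σ-μ {suc zero}      _ = refl
Σ-μ {n@(suc (suc _))} 0<n with ∃-prime-divisor n (s≤s (s≤s z≤n))
... | p , p-prime , p∣n = begin
  Σ (divisors n) μℚ                                       ≡⟨ Σ-split (p ∣?_) (divisors n) μℚ ⟩
  Σ (divisors n) (λ k → 𝟙 (p ∣? k) * μℚ k) + X            ≡⟨ cong (_+ X) (Σ-divisors-multiples 0<n p∣n μℚ) ⟩
  Σ (divisors m) (λ j → μℚ (p ℕ.* j)) + X                 ≡⟨ cong (_+ X) (Σ-cong (divisors m) μℚ-p*) ⟩
  Σ (divisors m) (λ j → 𝟙 (p∤? j) * - μℚ j) + X           ≡⟨ cong (_+ X) (Σ-cong (divisors m) (λ {j} _ →
                                                               sym (ℚP.neg-distribʳ-* (𝟙 (p∤? j)) (μℚ j)))) ⟩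
  Σ (divisors m) (λ j → - (𝟙 (p∤? j) * μℚ j)) + X         ≡⟨ cong (_+ X) (sym (Σ-neg (divisors m) _)) ⟩
  - Σ (divisors m) (λ j → 𝟙 (p∤? j) * μℚ j) + X           ≡⟨ cong (λ s → - s + X) coprime-part ⟩
  - X + X                                                 ≡⟨ ℚP.+-inverseˡ X ⟩
  0ℚ                                                      ≡⟨ sym (𝟙-no (n ≟ 1) (λ ())) ⟩
  𝟙 (n ≟ 1)                                               ∎
  where
  open ≡-Reasoning
  m = n div p
  0<p = prime>0 p-prime
  p∤? : ∀ k → Dec (¬ p ∣ k)
  p∤? k = ¬? (p ∣? k)
  X = Σ (divisors n) (λ k → 𝟙 (p∤? k) * μℚ k)
  μℚ-p* : ∀ {j} → j ∈ divisors m → μℚ (p ℕ.* j) ≡ 𝟙 (p∤? j) * - μℚ j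
  μℚ-p* {j} j∈ with p ∣? j
  ... | yes p∣j = ≡-trans (cong fromℤ (μ-square 0<pj (prime>1 p-prime) (*-monoʳ-∣ p p∣j))) (sym (ℚP.*-zeroˡ (- μℚ j)))
    where 0<pj = ℕP.*-mono-≤ 0<p (∈-divisors⇒pos m j∈)
  ... | no p∤j  = ≡-trans (≡-trans (cong fromℤ (μ-* p-prime p∤j (∈-divisors⇒pos m j∈))) (fromℤ-neg (μ j)))
                          (sym (ℚP.*-identityˡ (- μℚ j)))
  coprime-part : Σ (divisors m) (λ j → 𝟙 (p∤? j) * μℚ j) ≡ X
  coprime-part = begin
    Σ (divisors m) (λ j → 𝟙 (p∤? j) * μℚ j) ≡⟨ sym (Σ-filter p∤? (divisors m) μℚ) ⟩
    Σ (filter p∤? (divisors m)) μℚ          ≡⟨ Σ-unique-sameElements μℚ (Unique.filter⁺ p∤? (divisors-unique m))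
                                                 (Unique.filter⁺ p∤? (divisors-unique n)) (mk⇔ to from) ⟩
    Σ (filter p∤? (divisors n)) μℚ          ≡⟨ Σ-filter p∤? (divisors n) μℚ ⟩
    X                                       ∎
    where
    to : ∀ {k} → k ∈ filter p∤? (divisors m) → k ∈ filter p∤? (divisors n)
    to k∈ with ∈-filter⁻ p∤? {xs = divisors m} k∈
    ... | k∈m , p∤k = ∈-filter⁺ p∤? (∈-divisors⁺ 0<n (∣-trans (∈-divisors⇒∣ m k∈m) (div-∣ 0<p p∣n))) p∤k
    from : ∀ {k} → k ∈ filter p∤? (divisors n) → k ∈ filter p∤? (divisors m)
    from {k} k∈ with ∈-filter⁻ p∤? {xs = divisors n} k∈
    ... | k∈n , p∤k = ∈-filter⁺ p∤? (∈-divisors⁺ (div-pos 0<n p∣n)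
      (Coprime.coprime-divisor (prime∤⇒coprime p-prime p∤k)
        (subst (k ∣_) (sym (div-cancelˡ 0<p p∣n)) (∈-divisors⇒∣ n k∈n)))) p∤k

Σ-μ-quotient : ∀ {n b} → 0 < n → 0 < b → Σ (divisors n) (λ m → 𝟙 (b ∣? m) * μℚ (m div b)) ≡ 𝟙 (n ≟ b)
Σ-μ-quotient {n} {b} 0<n 0<b with b ∣? n
... | no b∤n = ≡-trans (Σ-zero (divisors n) (λ {m} m∈ → ≡-trans (cong (_* μℚ (m div b))
                         (𝟙-no (b ∣? m) (λ b∣m → b∤n (∣-trans b∣m (∈-divisors⇒∣ n m∈))))) (ℚP.*-zeroˡ (μℚ (m div b)))))
                       (sym (𝟙-no (n ≟ b) (λ { refl → b∤n ∣-refl })))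
... | yes b∣n = begin
  Σ (divisors n) (λ m → 𝟙 (b ∣? m) * μℚ (m div b)) ≡⟨ Σ-divisors-multiples 0<n b∣n (λ m → μℚ (m div b)) ⟩
  Σ (divisors (n div b)) (λ j → μℚ ((b ℕ.* j) div b)) ≡⟨ Σ-cong (divisors (n div b)) (λ {j} _ →
                                                         cong μℚ (div-unique {b ℕ.* j} {b} {j} 0<b (ℕP.*-comm j b))) ⟩
  Σ (divisors (n div b)) μℚ                          ≡⟨ Σ-μ (div-pos 0<n b∣n) ⟩
  𝟙 (n div b ≟ 1)                                    ≡⟨ 𝟙-cong (n div b ≟ 1) (n ≟ b) to from ⟩
  𝟙 (n ≟ b)                                          ∎
  where
  open ≡-Reasoning
  open Equivalence (div≡1⇔≡ 0<b b∣n) using (to; from)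

Σ-μ-cofactor : ∀ {n f} → 0 < n → 0 < f → Σ (divisors n) (λ d → 𝟙 (f ∣? d) * μℚ (n div d)) ≡ 𝟙 (f ≟ n)
Σ-μ-cofactor {n} {f} 0<n 0<f with f ∣? n
... | no f∤n = ≡-trans (Σ-zero (divisors n) (λ {d} d∈ → ≡-trans (cong (_* μℚ (n div d))
                         (𝟙-no (f ∣? d) (λ f∣d → f∤n (∣-trans f∣d (∈-divisors⇒∣ n d∈))))) (ℚP.*-zeroˡ (μℚ (n div d)))))
                       (sym (𝟙-no (f ≟ n) (λ { refl → f∤n ∣-refl })))
... | yes f∣n = begin
  Σ (divisors n) (λ d → 𝟙 (f ∣? d) * μℚ (n div d)) ≡⟨ Σ-divisors-multiples 0<n f∣n (λ d → μℚ (n div d)) ⟩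
  Σ (divisors m) (λ j → μℚ (n div (f ℕ.* j)))      ≡⟨ Σ-cong (divisors m) (λ j∈ →
                                                        cong μℚ (div-*-assoc 0<n f∣n (∈-divisors⇒∣ m j∈))) ⟩
  Σ (divisors m) (λ j → μℚ (m div j))               ≡⟨ Σ-divisors-complement 0<m μℚ ⟩
  Σ (divisors m) μℚ                                 ≡⟨ Σ-μ 0<m ⟩
  𝟙 (m ≟ 1)                                         ≡⟨ 𝟙-cong (m ≟ 1) (f ≟ n) (sym ∘ to) (from ∘ sym) ⟩
  𝟙 (f ≟ n)                                         ∎
  where
  open ≡-Reasoning
  m = n div f
  0<m = div-pos 0<n f∣n
  open Equivalence (div≡1⇔≡ 0<f f∣n) using (to; from)

-- Euler's totient function

totatives : ℕ → List ℕ
totatives n = filter (λ k → gcd k n ≟ 1) (range1 n)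

φ-pos : ∀ {n} → 0 < n → 0 < φ n
φ-pos {n} 0<n = nonEmpty (∈-filter⁺ (λ k → gcd k n ≟ 1) (∈-range1⁺ (s≤s z≤n) 0<n) (gcd-zeroˡ n))
  where
  nonEmpty : ∀ {xs : List ℕ} {x} → x ∈ xs → 0 < length xs
  nonEmpty (here _)  = s≤s z≤n
  nonEmpty (there _) = s≤s z≤n

gcd-fibre-size : ∀ {n d} → 0 < n → d ∣ n →
                 Σ (filter (λ k → gcd k n ≟ d) (range1 n)) (λ _ → 1ℚ) ≡ fromℕ (φ (n div d))
gcd-fibre-size {n} {d} 0<n d∣n = begin
  Σ (filter (λ k → gcd k n ≟ d) (range1 n)) (λ _ → 1ℚ)
    ≡⟨ Σ-unique-sameElements (λ _ → 1ℚ) (Unique.filter⁺ (λ k → gcd k n ≟ d) (range1-unique n))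
         (Unique.map⁺ (ℕP.*-cancelˡ-≡ _ _ d {{ℕ.>-nonZero 0<d}}) (Unique.filter⁺ (λ k → gcd k m ≟ 1) (range1-unique m)))
         (mk⇔ to from) ⟩
  Σ (map (d ℕ.*_) (totatives m)) (λ _ → 1ℚ) ≡⟨ Σ-map (totatives m) (d ℕ.*_) (λ _ → 1ℚ) ⟩
  Σ (totatives m) (λ _ → 1ℚ)                 ≡⟨ sym (fromℕ-length (totatives m)) ⟩
  fromℕ (φ m)                                ∎
  where
  open ≡-Reasoning
  m = n div d
  0<d = divisor-pos 0<n d∣n
  gcd-d* : ∀ j → gcd (d ℕ.* j) n ≡ d ℕ.* gcd j m
  gcd-d* j = ≡-trans (cong (gcd (d ℕ.* j)) (sym (div-cancelˡ 0<d d∣n))) (sym (c*gcd[m,n]≡gcd[cm,cn] d j m))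
  to : ∀ {k} → k ∈ filter (λ k → gcd k n ≟ d) (range1 n) → k ∈ map (d ℕ.*_) (totatives m)
  to {k} k∈ with ∈-filter⁻ (λ k → gcd k n ≟ d) {xs = range1 n} k∈
  ... | k∈n , gcd≡d = subst (_∈ map (d ℕ.*_) (totatives m)) (div-cancelˡ 0<d d∣k)
        (∈-map⁺ (d ℕ.*_) (∈-filter⁺ (λ k → gcd k m ≟ 1) (∈-range1⁺ (div-pos (proj₁ (∈-range1⁻ k∈n)) d∣k) j≤m) gcd≡1))
    where
    d∣k = subst (_∣ k) gcd≡d (gcd[m,n]∣m k n)
    j≤m : k div d ≤ m
    j≤m = ℕP.*-cancelˡ-≤ d {{ℕ.>-nonZero 0<d}}
            (subst₂ _≤_ (sym (div-cancelˡ 0<d d∣k)) (sym (div-cancelˡ 0<d d∣n)) (proj₂ (∈-range1⁻ k∈n)))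
    gcd≡1 : gcd (k div d) m ≡ 1
    gcd≡1 = ℕP.*-cancelˡ-≡ _ _ d {{ℕ.>-nonZero 0<d}} (begin
      d ℕ.* gcd (k div d) m  ≡⟨ sym (gcd-d* (k div d)) ⟩
      gcd (d ℕ.* (k div d)) n ≡⟨ cong (λ k′ → gcd k′ n) (div-cancelˡ 0<d d∣k) ⟩
      gcd k n                ≡⟨ gcd≡d ⟩
      d                      ≡⟨ sym (ℕP.*-identityʳ d) ⟩
      d ℕ.* 1                ∎)
  from : ∀ {k} → k ∈ map (d ℕ.*_) (totatives m) → k ∈ filter (λ k → gcd k n ≟ d) (range1 n)
  from k∈ with ∈-map⁻ (d ℕ.*_) k∈
  ... | j , j∈ , refl with ∈-filter⁻ (λ k → gcd k m ≟ 1) {xs = range1 m} j∈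
  ...   | j∈m , gcd≡1 = ∈-filter⁺ (λ k → gcd k n ≟ d)
          (∈-range1⁺ (ℕP.*-mono-≤ 0<d (proj₁ (∈-range1⁻ j∈m)))
                     (subst (d ℕ.* j ≤_) (div-cancelˡ 0<d d∣n) (ℕP.*-monoʳ-≤ d (proj₂ (∈-range1⁻ j∈m)))))
          (≡-trans (gcd-d* j) (≡-trans (cong (d ℕ.*_) gcd≡1) (ℕP.*-identityʳ d)))

Σ-φ : ∀ {n} → 0 < n → Σ (divisors n) (λ d → fromℕ (φ d)) ≡ fromℕ n
Σ-φ {n} 0<n = sym (begin
  fromℕ n
    ≡⟨ cong fromℕ (sym (length-range1 n)) ⟩
  fromℕ (length (range1 n))
    ≡⟨ fromℕ-length (range1 n) ⟩
  Σ (range1 n) (λ _ → 1ℚ)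
    ≡⟨ Σ-fibres (range1 n) (λ k → gcd k n) (λ _ → 1ℚ) (divisors-unique n) (λ {k} _ → ∈-divisors⁺ 0<n (gcd[m,n]∣n k n)) ⟩
  Σ (divisors n) (λ d → Σ (range1 n) (λ k → 𝟙 (gcd k n ≟ d) * 1ℚ))
    ≡⟨ Σ-cong (divisors n) (λ {d} d∈ → ≡-trans (sym (Σ-filter (λ k → gcd k n ≟ d) (range1 n) (λ _ → 1ℚ)))
                                               (gcd-fibre-size 0<n (∈-divisors⇒∣ n d∈))) ⟩
  Σ (divisors n) (λ d → fromℕ (φ (n div d)))
    ≡⟨ Σ-divisors-complement 0<n (λ d → fromℕ (φ d)) ⟩
  Σ (divisors n) (λ d → fromℕ (φ d)) ∎)
  where
  open ≡-Reasoning
  length-range1 : ∀ n → length (range1 n) ≡ n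
  length-range1 n = ≡-trans (List.length-map suc (upTo n)) (List.length-applyUpTo (λ x → x) n)

Σ-φ-multiples : ∀ {N l} → 0 < N → l ∣ N →
                Σ (divisors N) (λ b → 𝟙 (l ∣? b) * fromℕ (φ (N div b))) ≡ fromℕ (N div l)
Σ-φ-multiples {N} {l} 0<N l∣N = begin
  Σ (divisors N) (λ b → 𝟙 (l ∣? b) * fromℕ (φ (N div b))) ≡⟨ Σ-divisors-multiples 0<N l∣N (λ b → fromℕ (φ (N div b))) ⟩
  Σ (divisors m) (λ j → fromℕ (φ (N div (l ℕ.* j))))      ≡⟨ Σ-cong (divisors m) (λ j∈ →
                                                               cong (fromℕ ∘ φ) (div-*-assoc 0<N l∣N (∈-divisors⇒∣ m j∈))) ⟩
  Σ (divisors m) (λ j → fromℕ (φ (m div j)))              ≡⟨ Σ-divisors-complement 0<m (fromℕ ∘ φ) ⟩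
  Σ (divisors m) (λ j → fromℕ (φ j))                      ≡⟨ Σ-φ 0<m ⟩
  fromℕ m                                                 ∎
  where
  open ≡-Reasoning
  m = N div l
  0<m = div-pos 0<N l∣N

Σ-φ-common-divisors : ∀ {n d e} → 0 < n → d ∣ n →
  Σ (divisors n) (λ f → 𝟙 (f ∣? d) * 𝟙 (f ∣? e) * fromℕ (φ f)) ≡ fromℕ (gcd d e)
Σ-φ-common-divisors {n} {d} {e} 0<n d∣n = begin
  Σ (divisors n) (λ f → 𝟙 (f ∣? d) * 𝟙 (f ∣? e) * fromℕ (φ f)) ≡⟨ Σ-cong (divisors n) (λ {f} _ →
                                                                   cong (_* fromℕ (φ f)) (𝟙-∣-gcd d e f)) ⟩
  Σ (divisors n) (λ f → 𝟙 (f ∣? gcd d e) * fromℕ (φ f))       ≡⟨ Σ-divisors-∣ 0<n g∣n (fromℕ ∘ φ) ⟩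
  Σ (divisors (gcd d e)) (λ f → fromℕ (φ f))                  ≡⟨ Σ-φ (divisor-pos 0<n g∣n) ⟩
  fromℕ (gcd d e)                                             ∎
  where
  open ≡-Reasoning
  g∣n = ∣-trans (gcd[m,n]∣m d e) d∣n

Σ-μ-μ-gcd : ∀ {v w} → 0 < v → 0 < w →
  Σ (divisors v) (λ d → Σ (divisors w) (λ e → μℚ (v div d) * μℚ (w div e) * fromℕ (gcd d e)))
  ≡ 𝟙 (v ≟ w) * fromℕ (φ v)
Σ-μ-μ-gcd {v} {w} 0<v 0<w = begin
  Σ (divisors v) (λ d → Σ (divisors w) (λ e → μv d * μw e * fromℕ (gcd d e)))
    ≡⟨ Σ-cong (divisors v) (λ d∈ → Σ-cong (divisors w) (λ _ → expand-gcd d∈)) ⟩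
  Σ (divisors v) (λ d → Σ (divisors w) (λ e → Σ (divisors v) (λ f → φℚ f * X f d * Y f e)))
    ≡⟨ Σ-swap₃ (divisors v) (divisors w) (divisors v) (λ d e f → φℚ f * X f d * Y f e) ⟩
  Σ (divisors v) (λ f → Σ (divisors v) (λ d → Σ (divisors w) (λ e → φℚ f * X f d * Y f e)))
    ≡⟨ Σ-cong (divisors v) (λ {f} _ → sym (factor f)) ⟩
  Σ (divisors v) (λ f → φℚ f * Σ (divisors v) (X f) * Σ (divisors w) (Y f))
    ≡⟨ Σ-cong (divisors v) (λ {f} f∈ → cong₂ (λ s t → φℚ f * s * t)
         (Σ-μ-cofactor {v} {f} 0<v (∈-divisors⇒pos v f∈)) (Σ-μ-cofactor {w} {f} 0<w (∈-divisors⇒pos v f∈))) ⟩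
  Σ (divisors v) (λ f → φℚ f * 𝟙 (f ≟ v) * 𝟙 (f ≟ w))
    ≡⟨ Σ-cong (divisors v) (λ {f} _ → diagonal f) ⟩
  Σ (divisors v) (λ f → 𝟙 (f ≟ v) * (𝟙 (v ≟ w) * φℚ f))
    ≡⟨ Σ-δ (λ f → 𝟙 (v ≟ w) * φℚ f) (divisors-unique v) (∈-divisors⁺ 0<v ∣-refl) ⟩
  𝟙 (v ≟ w) * φℚ v ∎
  where
  open ≡-Reasoning
  φℚ μv μw : ℕ → ℚ
  φℚ = fromℕ ∘ φ
  μv d = μℚ (v div d)
  μw e = μℚ (w div e)
  X Y : ℕ → ℕ → ℚ
  X f d = 𝟙 (f ∣? d) * μv d
  Y f e = 𝟙 (f ∣? e) * μw e
  expand-gcd : ∀ {d e} → d ∈ divisors v →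
               μv d * μw e * fromℕ (gcd d e) ≡ Σ (divisors v) (λ f → φℚ f * X f d * Y f e)
  expand-gcd {d} {e} d∈ = begin
    μv d * μw e * fromℕ (gcd d e)
      ≡⟨ cong (μv d * μw e *_) (sym (Σ-φ-common-divisors 0<v (∈-divisors⇒∣ v d∈))) ⟩
    μv d * μw e * Σ (divisors v) (λ f → 𝟙 (f ∣? d) * 𝟙 (f ∣? e) * φℚ f)
      ≡⟨ Σ-*ˡ (divisors v) (μv d * μw e) _ ⟩
    Σ (divisors v) (λ f → μv d * μw e * (𝟙 (f ∣? d) * 𝟙 (f ∣? e) * φℚ f))
      ≡⟨ Σ-cong (divisors v) (λ {f} _ → solve 5 (λ a b x y p → (a :* b) :* ((x :* y) :* p) := (p :* (x :* a)) :* (y :* b))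
           refl (μv d) (μw e) (𝟙 (f ∣? d)) (𝟙 (f ∣? e)) (φℚ f)) ⟩
    Σ (divisors v) (λ f → φℚ f * X f d * Y f e) ∎
  factor : ∀ f → φℚ f * Σ (divisors v) (X f) * Σ (divisors w) (Y f)
               ≡ Σ (divisors v) (λ d → Σ (divisors w) (λ e → φℚ f * X f d * Y f e))
  factor f = ≡-trans (cong (_* Σ (divisors w) (Y f)) (Σ-*ˡ (divisors v) (φℚ f) (X f)))
                     (Σ-*-Σ (divisors v) (divisors w) (λ d → φℚ f * X f d) (Y f))
  diagonal : ∀ f → φℚ f * 𝟙 (f ≟ v) * 𝟙 (f ≟ w) ≡ 𝟙 (f ≟ v) * (𝟙 (v ≟ w) * φℚ f)
  diagonal f = begin
    φℚ f * 𝟙 (f ≟ v) * 𝟙 (f ≟ w)   ≡⟨ ℚP.*-assoc (φℚ f) (𝟙 (f ≟ v)) (𝟙 (f ≟ w)) ⟩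
    φℚ f * (𝟙 (f ≟ v) * 𝟙 (f ≟ w)) ≡⟨ cong (φℚ f *_) (𝟙-≟-* f v w) ⟩
    φℚ f * (𝟙 (f ≟ v) * 𝟙 (v ≟ w)) ≡⟨ solve 3 (λ p a b → p :* (a :* b) := a :* (b :* p)) refl (φℚ f) (𝟙 (f ≟ v)) (𝟙 (v ≟ w)) ⟩
    𝟙 (f ≟ v) * (𝟙 (v ≟ w) * φℚ f) ∎

-- Ramanujan sums

ramanujan : ℕ → ℕ → ℚ
ramanujan v b = Σ (divisors v) (λ d → 𝟙 (d ∣? b) * (μℚ (v div d) * fromℕ d))

Σ-φ-ramanujan-product : ∀ {N v w} → 0 < N → v ∣ N → w ∣ N →
  Σ (divisors N) (λ b → fromℕ (φ (N div b)) * (ramanujan v b * ramanujan w b))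
  ≡ fromℕ N * Σ (divisors v) (λ d → Σ (divisors w) (λ e → μℚ (v div d) * μℚ (w div e) * fromℕ (gcd d e)))
Σ-φ-ramanujan-product {N} {v} {w} 0<N v∣N w∣N = begin
  Σ (divisors N) (λ b → φN b * (ramanujan v b * ramanujan w b))
    ≡⟨ Σ-cong (divisors N) (λ {b} _ → ≡-trans (cong (φN b *_) (Σ-*-Σ (divisors v) (divisors w) (I b) (J b)))
                                              (Σ-*ˡ-Σ (divisors v) (divisors w) (φN b) (λ d e → I b d * J b e))) ⟩
  Σ (divisors N) (λ b → Σ (divisors v) (λ d → Σ (divisors w) (λ e → φN b * (I b d * J b e))))
    ≡⟨ Σ-swap (divisors N) (divisors v) (λ b d → Σ (divisors w) (λ e → φN b * (I b d * J b e))) ⟩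
  Σ (divisors v) (λ d → Σ (divisors N) (λ b → Σ (divisors w) (λ e → φN b * (I b d * J b e))))
    ≡⟨ Σ-cong (divisors v) (λ {d} _ → Σ-swap (divisors N) (divisors w) (λ b e → φN b * (I b d * J b e))) ⟩
  Σ (divisors v) (λ d → Σ (divisors w) (λ e → Σ (divisors N) (λ b → φN b * (I b d * J b e))))
    ≡⟨ Σ-cong (divisors v) (λ d∈ → Σ-cong (divisors w) (λ e∈ → collapse-b d∈ e∈)) ⟩
  Σ (divisors v) (λ d → Σ (divisors w) (λ e → fromℕ N * (μv d * μw e * fromℕ (gcd d e))))
    ≡⟨ sym (Σ-*ˡ-Σ (divisors v) (divisors w) (fromℕ N) (λ d e → μv d * μw e * fromℕ (gcd d e))) ⟩
  fromℕ N * Σ (divisors v) (λ d → Σ (divisors w) (λ e → μv d * μw e * fromℕ (gcd d e))) ∎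
  where
  open ≡-Reasoning
  φN μv μw α β : ℕ → ℚ
  φN b = fromℕ (φ (N div b))
  μv d = μℚ (v div d)
  μw e = μℚ (w div e)
  α d = μv d * fromℕ d
  β e = μw e * fromℕ e
  I J : ℕ → ℕ → ℚ
  I b d = 𝟙 (d ∣? b) * α d
  J b e = 𝟙 (e ∣? b) * β e
  collapse-b : ∀ {d e} → d ∈ divisors v → e ∈ divisors w →
    Σ (divisors N) (λ b → φN b * (I b d * J b e)) ≡ fromℕ N * (μv d * μw e * fromℕ (gcd d e))
  collapse-b {d} {e} d∈ e∈ = begin
    Σ (divisors N) (λ b → φN b * (I b d * J b e))
      ≡⟨ Σ-cong (divisors N) (λ {b} _ → solve 5 (λ p i a j b → p :* ((i :* a) :* (j :* b)) := (a :* b) :* ((i :* j) :* p))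
           refl (φN b) (𝟙 (d ∣? b)) (α d) (𝟙 (e ∣? b)) (β e)) ⟩
    Σ (divisors N) (λ b → α d * β e * (𝟙 (d ∣? b) * 𝟙 (e ∣? b) * φN b))
      ≡⟨ sym (Σ-*ˡ (divisors N) (α d * β e) _) ⟩
    α d * β e * Σ (divisors N) (λ b → 𝟙 (d ∣? b) * 𝟙 (e ∣? b) * φN b)
      ≡⟨ cong (α d * β e *_) (≡-trans (Σ-cong (divisors N) (λ {b} _ → cong (_* φN b) (𝟙-∣-lcm d e b)))
                                      (Σ-φ-multiples 0<N (lcm-least d∣N e∣N))) ⟩
    α d * β e * fromℕ (N div lcm d e)
      ≡⟨ solve 5 (λ a b x y z → (a :* x) :* (b :* y) :* z := (a :* b) :* (z :* (x :* y)))
           refl (μv d) (μw e) (fromℕ d) (fromℕ e) (fromℕ (N div lcm d e)) ⟩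
    μv d * μw e * (fromℕ (N div lcm d e) * (fromℕ d * fromℕ e))
      ≡⟨ cong (μv d * μw e *_) (sym (≡-trans (fromℕ-* (N div lcm d e) (d ℕ.* e)) (cong (fromℕ (N div lcm d e) *_) (fromℕ-* d e)))) ⟩
    μv d * μw e * fromℕ (N div lcm d e ℕ.* (d ℕ.* e))
      ≡⟨ cong (λ n → μv d * μw e * fromℕ n) (div-lcm-* 0<N d∣N e∣N) ⟩
    μv d * μw e * fromℕ (N ℕ.* gcd d e)
      ≡⟨ cong (μv d * μw e *_) (fromℕ-* N (gcd d e)) ⟩
    μv d * μw e * (fromℕ N * fromℕ (gcd d e))
      ≡⟨ solve 4 (λ a b n g → a :* b :* (n :* g) := n :* (a :* b :* g)) refl (μv d) (μw e) (fromℕ N) (fromℕ (gcd d e)) ⟩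
    fromℕ N * (μv d * μw e * fromℕ (gcd d e)) ∎
    where
    d∣N = ∣-trans (∈-divisors⇒∣ v d∈) v∣N
    e∣N = ∣-trans (∈-divisors⇒∣ w e∈) w∣N

ramanujan-orthogonal : ∀ {N v w} → 0 < N → v ∣ N → w ∣ N →
  Σ (divisors N) (λ b → fromℕ (φ (N div b)) * (ramanujan v b * ramanujan w b)) ≡ 𝟙 (v ≟ w) * (fromℕ N * fromℕ (φ v))
ramanujan-orthogonal {N} {v} {w} 0<N v∣N w∣N = begin
  Σ (divisors N) (λ b → fromℕ (φ (N div b)) * (ramanujan v b * ramanujan w b))
    ≡⟨ Σ-φ-ramanujan-product 0<N v∣N w∣N ⟩
  fromℕ N * Σ (divisors v) (λ d → Σ (divisors w) (λ e → μℚ (v div d) * μℚ (w div e) * fromℕ (gcd d e)))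
    ≡⟨ cong (fromℕ N *_) (Σ-μ-μ-gcd (divisor-pos 0<N v∣N) (divisor-pos 0<N w∣N)) ⟩
  fromℕ N * (𝟙 (v ≟ w) * fromℕ (φ v))
    ≡⟨ solve 3 (λ n i p → n :* (i :* p) := i :* (n :* p)) refl (fromℕ N) (𝟙 (v ≟ w)) (fromℕ (φ v)) ⟩
  𝟙 (v ≟ w) * (fromℕ N * fromℕ (φ v)) ∎
  where open ≡-Reasoning

Σ-ramanujan-divisors : ∀ {m} → 0 < m → ∀ b → Σ (divisors m) (λ w → ramanujan w b) ≡ 𝟙 (m ∣? b) * fromℕ m
Σ-ramanujan-divisors {m} 0<m b = begin
  Σ (divisors m) (λ w → ramanujan w b)
    ≡⟨ Σ-cong (divisors m) (λ {w} w∈ → sym (Σ-divisors-∣ 0<m (∈-divisors⇒∣ m w∈) (λ d → 𝟙 (d ∣? b) * (μℚ (w div d) * fromℕ d)))) ⟩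
  Σ (divisors m) (λ w → Σ (divisors m) (λ d → 𝟙 (d ∣? w) * (𝟙 (d ∣? b) * (μℚ (w div d) * fromℕ d))))
    ≡⟨ Σ-swap (divisors m) (divisors m) _ ⟩
  Σ (divisors m) (λ d → Σ (divisors m) (λ w → 𝟙 (d ∣? w) * (𝟙 (d ∣? b) * (μℚ (w div d) * fromℕ d))))
    ≡⟨ Σ-cong (divisors m) (λ {d} _ → ≡-trans (Σ-cong (divisors m) (λ {w} _ →
         solve 4 (λ i j μ x → i :* (j :* (μ :* x)) := (j :* x) :* (i :* μ)) refl (𝟙 (d ∣? w)) (𝟙 (d ∣? b)) (μℚ (w div d)) (fromℕ d)))
         (sym (Σ-*ˡ (divisors m) (𝟙 (d ∣? b) * fromℕ d) (λ w → 𝟙 (d ∣? w) * μℚ (w div d))))) ⟩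
  Σ (divisors m) (λ d → 𝟙 (d ∣? b) * fromℕ d * Σ (divisors m) (λ w → 𝟙 (d ∣? w) * μℚ (w div d)))
    ≡⟨ Σ-cong (divisors m) (λ {d} d∈ → ≡-trans (cong (𝟙 (d ∣? b) * fromℕ d *_) (Σ-μ-quotient {m} {d} 0<m (∈-divisors⇒pos m d∈)))
         (≡-trans (ℚP.*-comm _ (𝟙 (m ≟ d))) (cong (_* (𝟙 (d ∣? b) * fromℕ d)) (𝟙-cong (m ≟ d) (d ≟ m) sym sym)))) ⟩
  Σ (divisors m) (λ d → 𝟙 (d ≟ m) * (𝟙 (d ∣? b) * fromℕ d))
    ≡⟨ Σ-δ (λ d → 𝟙 (d ∣? b) * fromℕ d) (divisors-unique m) (∈-divisors⁺ 0<m ∣-refl) ⟩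
  𝟙 (m ∣? b) * fromℕ m ∎
  where open ≡-Reasoning

multiplesSum : ℕ → (ℕ → ℚ) → ℕ → ℚ
multiplesSum N E m = Σ (divisors N) (λ b → 𝟙 (m ∣? b) * E b)

multiplesSum-ramanujan : ∀ {N m} → 0 < N → m ∣ N → ∀ E →
  fromℕ m * multiplesSum N E m ≡ Σ (divisors m) (λ w → Σ (divisors N) (λ b → E b * ramanujan w b))
multiplesSum-ramanujan {N} {m} 0<N m∣N E = begin
  fromℕ m * Σ (divisors N) (λ b → 𝟙 (m ∣? b) * E b)
    ≡⟨ Σ-*ˡ (divisors N) (fromℕ m) _ ⟩
  Σ (divisors N) (λ b → fromℕ m * (𝟙 (m ∣? b) * E b))
    ≡⟨ Σ-cong (divisors N) (λ {b} _ → ≡-trans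
         (solve 3 (λ n i e → n :* (i :* e) := (i :* n) :* e) refl (fromℕ m) (𝟙 (m ∣? b)) (E b))
         (cong (_* E b) (sym (Σ-ramanujan-divisors (divisor-pos 0<N m∣N) b)))) ⟩
  Σ (divisors N) (λ b → Σ (divisors m) (λ w → ramanujan w b) * E b)
    ≡⟨ Σ-cong (divisors N) (λ {b} _ → ≡-trans (Σ-*ʳ (divisors m) (E b) (λ w → ramanujan w b))
                                              (Σ-cong (divisors m) (λ {w} _ → ℚP.*-comm (ramanujan w b) (E b)))) ⟩
  Σ (divisors N) (λ b → Σ (divisors m) (λ w → E b * ramanujan w b))
    ≡⟨ Σ-swap (divisors N) (divisors m) (λ b w → E b * ramanujan w b) ⟩
  Σ (divisors m) (λ w → Σ (divisors N) (λ b → E b * ramanujan w b)) ∎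
  where open ≡-Reasoning

multiplesSum-möbius : ∀ {N b} → 0 < N → b ∣ N → ∀ E →
  E b ≡ Σ (divisors N) (λ m → 𝟙 (b ∣? m) * μℚ (m div b) * multiplesSum N E m)
multiplesSum-möbius {N} {b} 0<N b∣N E = begin
  E b
    ≡⟨ sym (Σ-δ E (divisors-unique N) (∈-divisors⁺ 0<N b∣N)) ⟩
  Σ (divisors N) (λ b′ → 𝟙 (b′ ≟ b) * E b′)
    ≡⟨ Σ-cong (divisors N) (λ {b′} b′∈ → cong (_* E b′) (sym (δ-möbius b′∈))) ⟩
  Σ (divisors N) (λ b′ → Σ (divisors N) (λ m → 𝟙 (m ∣? b′) * M m) * E b′)
    ≡⟨ Σ-cong (divisors N) (λ {b′} _ → ≡-trans (Σ-*ʳ (divisors N) (E b′) (λ m → 𝟙 (m ∣? b′) * M m))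
         (Σ-cong (divisors N) (λ {m} _ → solve 3 (λ i μ e → i :* μ :* e := μ :* (i :* e)) refl (𝟙 (m ∣? b′)) (M m) (E b′)))) ⟩
  Σ (divisors N) (λ b′ → Σ (divisors N) (λ m → M m * (𝟙 (m ∣? b′) * E b′)))
    ≡⟨ Σ-swap (divisors N) (divisors N) (λ b′ m → M m * (𝟙 (m ∣? b′) * E b′)) ⟩
  Σ (divisors N) (λ m → Σ (divisors N) (λ b′ → M m * (𝟙 (m ∣? b′) * E b′)))
    ≡⟨ Σ-cong (divisors N) (λ {m} _ → sym (Σ-*ˡ (divisors N) (M m) (λ b′ → 𝟙 (m ∣? b′) * E b′))) ⟩
  Σ (divisors N) (λ m → M m * multiplesSum N E m) ∎
  where
  open ≡-Reasoning
  M : ℕ → ℚ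
  M m = 𝟙 (b ∣? m) * μℚ (m div b)
  δ-möbius : ∀ {b′} → b′ ∈ divisors N → Σ (divisors N) (λ m → 𝟙 (m ∣? b′) * M m) ≡ 𝟙 (b′ ≟ b)
  δ-möbius {b′} b′∈ = ≡-trans (Σ-divisors-∣ 0<N (∈-divisors⇒∣ N b′∈) M)
                              (Σ-μ-quotient {b′} {b} (∈-divisors⇒pos N b′∈) (divisor-pos 0<N b∣N))

ramanujan-transform-injective : ∀ {N} → 0 < N → ∀ E F →
  (∀ {w} → w ∈ divisors N → Σ (divisors N) (λ b → E b * ramanujan w b) ≡ Σ (divisors N) (λ b → F b * ramanujan w b)) →
  ∀ {b} → b ∈ divisors N → E b ≡ F b
ramanujan-transform-injective {N} 0<N E F same-transform {b} b∈ = begin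
  E b
    ≡⟨ multiplesSum-möbius 0<N b∣N E ⟩
  Σ (divisors N) (λ m → 𝟙 (b ∣? m) * μℚ (m div b) * multiplesSum N E m)
    ≡⟨ Σ-cong (divisors N) (λ {m} m∈ → cong (𝟙 (b ∣? m) * μℚ (m div b) *_) (same-multiplesSum m∈)) ⟩
  Σ (divisors N) (λ m → 𝟙 (b ∣? m) * μℚ (m div b) * multiplesSum N F m)
    ≡⟨ sym (multiplesSum-möbius 0<N b∣N F) ⟩
  F b ∎
  where
  open ≡-Reasoning
  b∣N = ∈-divisors⇒∣ N b∈
  same-multiplesSum : ∀ {m} → m ∈ divisors N → multiplesSum N E m ≡ multiplesSum N F m
  same-multiplesSum {m} m∈ = fromℕ-*-cancelˡ (∈-divisors⇒pos N m∈) (begin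
    fromℕ m * multiplesSum N E m
      ≡⟨ multiplesSum-ramanujan 0<N m∣N E ⟩
    Σ (divisors m) (λ w → Σ (divisors N) (λ b → E b * ramanujan w b))
      ≡⟨ Σ-cong (divisors m) (λ w∈ → same-transform (∈-divisors⁺ 0<N (∣-trans (∈-divisors⇒∣ m w∈) m∣N))) ⟩
    Σ (divisors m) (λ w → Σ (divisors N) (λ b → F b * ramanujan w b))
      ≡⟨ sym (multiplesSum-ramanujan 0<N m∣N F) ⟩
    fromℕ m * multiplesSum N F m ∎)
    where m∣N = ∈-divisors⇒∣ N m∈

ramanujan-dual : ∀ {N a b} → 0 < N → a ∣ N → b ∣ N →
  Σ (divisors N) (λ v → ramanujan v a * ramanujan v b * inv (φ v)) * fromℕ (φ (N div b)) ≡ 𝟙 (b ≟ a) * fromℕ N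
ramanujan-dual {N} {a} 0<N a∣N b∣N =
  ramanujan-transform-injective 0<N (λ b → T b * fromℕ (φ (N div b))) (λ b → 𝟙 (b ≟ a) * fromℕ N)
    same-transform (∈-divisors⁺ 0<N b∣N)
  where
  open ≡-Reasoning
  c = ramanujan
  T : ℕ → ℚ
  T b = Σ (divisors N) (λ v → c v a * c v b * inv (φ v))
  same-transform : ∀ {w} → w ∈ divisors N → Σ (divisors N) (λ b → T b * fromℕ (φ (N div b)) * c w b)
                                         ≡ Σ (divisors N) (λ b → 𝟙 (b ≟ a) * fromℕ N * c w b)
  same-transform {w} w∈ = begin
    Σ (divisors N) (λ b → T b * fromℕ (φ (N div b)) * c w b)
      ≡⟨ Σ-cong (divisors N) (λ {b} _ → ≡-trans (cong (_* c w b) (Σ-*ʳ (divisors N) (fromℕ (φ (N div b))) _))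
           (≡-trans (Σ-*ʳ (divisors N) (c w b) _) (Σ-cong (divisors N) (λ {v} _ →
             solve 5 (λ x y i f z → x :* y :* i :* f :* z := (x :* i) :* (f :* (y :* z)))
               refl (c v a) (c v b) (inv (φ v)) (fromℕ (φ (N div b))) (c w b))))) ⟩
    Σ (divisors N) (λ b → Σ (divisors N) (λ v → c v a * inv (φ v) * (fromℕ (φ (N div b)) * (c v b * c w b))))
      ≡⟨ Σ-swap (divisors N) (divisors N) _ ⟩
    Σ (divisors N) (λ v → Σ (divisors N) (λ b → c v a * inv (φ v) * (fromℕ (φ (N div b)) * (c v b * c w b))))
      ≡⟨ Σ-cong (divisors N) (λ {v} v∈ → ≡-trans (sym (Σ-*ˡ (divisors N) (c v a * inv (φ v)) _))
           (cong (c v a * inv (φ v) *_) (ramanujan-orthogonal 0<N (∈-divisors⇒∣ N v∈) (∈-divisors⇒∣ N w∈)))) ⟩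
    Σ (divisors N) (λ v → c v a * inv (φ v) * (𝟙 (v ≟ w) * (fromℕ N * fromℕ (φ v))))
      ≡⟨ Σ-cong (divisors N) (λ {v} v∈ → cancel-φ v∈) ⟩
    Σ (divisors N) (λ v → 𝟙 (v ≟ w) * (c v a * fromℕ N))
      ≡⟨ Σ-δ (λ v → c v a * fromℕ N) (divisors-unique N) w∈ ⟩
    c w a * fromℕ N
      ≡⟨ sym (Σ-δ (λ b → c w b * fromℕ N) (divisors-unique N) (∈-divisors⁺ 0<N a∣N)) ⟩
    Σ (divisors N) (λ b → 𝟙 (b ≟ a) * (c w b * fromℕ N))
      ≡⟨ Σ-cong (divisors N) (λ {b} _ → solve 3 (λ δ x n → δ :* (x :* n) := δ :* n :* x) refl (𝟙 (b ≟ a)) (c w b) (fromℕ N)) ⟩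
    Σ (divisors N) (λ b → 𝟙 (b ≟ a) * fromℕ N * c w b) ∎
    where
    cancel-φ : ∀ {v} → v ∈ divisors N →
               c v a * inv (φ v) * (𝟙 (v ≟ w) * (fromℕ N * fromℕ (φ v))) ≡ 𝟙 (v ≟ w) * (c v a * fromℕ N)
    cancel-φ {v} v∈ = begin
      c v a * inv (φ v) * (𝟙 (v ≟ w) * (fromℕ N * fromℕ (φ v)))
        ≡⟨ solve 5 (λ x i δ n f → x :* i :* (δ :* (n :* f)) := δ :* (x :* n) :* (i :* f))
             refl (c v a) (inv (φ v)) (𝟙 (v ≟ w)) (fromℕ N) (fromℕ (φ v)) ⟩
      𝟙 (v ≟ w) * (c v a * fromℕ N) * (inv (φ v) * fromℕ (φ v))
        ≡⟨ cong (𝟙 (v ≟ w) * (c v a * fromℕ N) *_) (inv-inverseˡ (φ-pos (∈-divisors⇒pos N v∈))) ⟩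
      𝟙 (v ≟ w) * (c v a * fromℕ N) * 1ℚ
        ≡⟨ ℚP.*-identityʳ _ ⟩
      𝟙 (v ≟ w) * (c v a * fromℕ N) ∎

G≡ramanujan : ∀ {N v} ξ → 0 < N → v ∣ N → fromℤ (G ξ v) ≡ ramanujan v (gcd ξ N)
G≡ramanujan {N} {v} ξ 0<N v∣N = begin
  fromℤ (G ξ v)
    ≡⟨ fromℤ-sumℤ (divisors (gcd v ξ)) (λ d → μ (v div d) ℤ.* + d) ⟩
  Σ (divisors (gcd v ξ)) (λ d → fromℤ (μ (v div d) ℤ.* + d))
    ≡⟨ Σ-cong (divisors (gcd v ξ)) (λ {d} _ → fromℤ-* (μ (v div d)) (+ d)) ⟩
  Σ (divisors (gcd v ξ)) (λ d → μℚ (v div d) * fromℕ d)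
    ≡⟨ sym (Σ-divisors-∣ 0<v (gcd[m,n]∣m v ξ) _) ⟩
  Σ (divisors v) (λ d → 𝟙 (d ∣? gcd v ξ) * (μℚ (v div d) * fromℕ d))
    ≡⟨ Σ-cong (divisors v) (λ {d} d∈ → cong (_* (μℚ (v div d) * fromℕ d)) (𝟙-cong (d ∣? gcd v ξ) (d ∣? gcd ξ N)
         (λ d∣g → gcd-greatest (∣-trans d∣g (gcd[m,n]∣n v ξ)) (∣-trans (∈-divisors⇒∣ v d∈) v∣N))
         (λ d∣g → gcd-greatest (∈-divisors⇒∣ v d∈) (∣-trans d∣g (gcd[m,n]∣m ξ N))))) ⟩
  ramanujan v (gcd ξ N) ∎
  where
  open ≡-Reasoning
  0<v = divisor-pos 0<N v∣N

S≡Σ-ramanujan : ∀ {N} ξ ξ′ → 0 < N →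
  S N ξ ξ′ ≡ Σ (divisors N) (λ v → ramanujan v (gcd ξ N) * ramanujan v (gcd ξ′ N) * inv (φ v))
S≡Σ-ramanujan {N} ξ ξ′ 0<N = Σ-cong (divisors N) (λ {v} v∈ → cong (_* inv (φ v))
  (≡-trans (fromℤ-* (G ξ v) (G ξ′ v))
           (cong₂ _*_ (G≡ramanujan ξ 0<N (∈-divisors⇒∣ N v∈)) (G≡ramanujan ξ′ 0<N (∈-divisors⇒∣ N v∈)))))

S-closed-form : ∀ {N} ξ ξ′ → 0 < N →
  S N ξ ξ′ ≡ 𝟙 (gcd ξ′ N ≟ gcd ξ N) * fromℕ N * inv (φ (N div gcd ξ′ N))
S-closed-form {N} ξ ξ′ 0<N = ≡-trans (S≡Σ-ramanujan ξ ξ′ 0<N)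
  (*-fromℕ⇒≡*inv (φ-pos (div-pos 0<N (gcd[m,n]∣n ξ′ N))) (ramanujan-dual 0<N (gcd[m,n]∣n ξ N) (gcd[m,n]∣n ξ′ N)))

mainTheorem5 : (N : ℕ) → (ξ ξ′ : Fin N) →
    ((d : ℕ) → gcd (toℕ ξ) N ≡ d → gcd (toℕ ξ′) N ≡ d →
        S N (toℕ ξ) (toℕ ξ′) ≡ (+ N ℚ./ 1) ℚ.* inv (φ (N div d)))
    × (gcd (toℕ ξ) N ≢ gcd (toℕ ξ′) N → S N (toℕ ξ) (toℕ ξ′) ≡ 0ℚ)
mainTheorem5 zero ()
mainTheorem5 N@(suc _) ξ ξ′ = same-gcd , different-gcd
  where
  open ≡-Reasoning
  x = toℕ ξ
  y = toℕ ξ′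
  same-gcd : (d : ℕ) → gcd x N ≡ d → gcd y N ≡ d → S N x y ≡ fromℕ N * inv (φ (N div d))
  same-gcd d refl gy≡gx = begin
    S N x y                                                  ≡⟨ S-closed-form x y (s≤s z≤n) ⟩
    𝟙 (gcd y N ≟ gcd x N) * fromℕ N * inv (φ (N div gcd y N)) ≡⟨ cong₂ (λ i n → i * fromℕ N * inv (φ (N div n)))
                                                                  (𝟙-yes (gcd y N ≟ gcd x N) gy≡gx) gy≡gx ⟩
    1ℚ * fromℕ N * inv (φ (N div gcd x N))                    ≡⟨ cong (_* inv (φ (N div gcd x N))) (ℚP.*-identityˡ (fromℕ N)) ⟩
    fromℕ N * inv (φ (N div gcd x N))                         ∎
  different-gcd : gcd x N ≢ gcd y N → S N x y ≡ 0ℚ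
  different-gcd gx≢gy = begin
    S N x y                                                  ≡⟨ S-closed-form x y (s≤s z≤n) ⟩
    𝟙 (gcd y N ≟ gcd x N) * fromℕ N * inv (φ (N div gcd y N)) ≡⟨ cong (λ i → i * fromℕ N * inv (φ (N div gcd y N)))
                                                                  (𝟙-no (gcd y N ≟ gcd x N) (gx≢gy ∘ sym)) ⟩
    0ℚ * fromℕ N * inv (φ (N div gcd y N))                    ≡⟨ cong (_* inv (φ (N div gcd y N))) (ℚP.*-zeroˡ (fromℕ N)) ⟩
    0ℚ * inv (φ (N div gcd y N))                              ≡⟨ ℚP.*-zeroˡ (inv (φ (N div gcd y N))) ⟩
    0ℚ                                                       ∎
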